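{- If $m$ is an odd positive integer, then \[ \limsup_{d\to\infty} \mathsf{s}_{2m}(\mathbb{Z}_2^d)\, 2^{ -d/m} \geq 2^{1-1/m}. \]
   Context: $\mathsf{s}_{2m}(\mathbb{Z}_2^d)$ denotes the smallest integer $s$ such that every sequence (repetitions allowed) of length $s$ of elements of $\mathbb{Z}_2^d$ has a subsequence of length $2m$ whose elements sum to $0$. -}

module Defs where

open import Data.Nat using (ℕ; zero; suc; _+_; _*_; _^_; _≤_; _<_; _∸_)
open import Data.Bool using (Bool; true; false; _xor_)
open import Data.Vec using (Vec; []; _∷_; zipWith; replicate)
open import Data.Fin using (Fin)
open import Data.Fin.Subset using (Subset; inside; outside; ∣_∣)
open import Relation.Binary.PropositionalEquality using (_≡_)
open import Data.Product using (Σ; _×_)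

Z2^ : ℕ → Set
Z2^ d = Vec Bool d

_⊕_ : ∀ {d} → Z2^ d → Z2^ d → Z2^ d
_⊕_ = zipWith _xor_

𝟘 : ∀ {d} → Z2^ d
𝟘 {d} = replicate d false

sumSel : ∀ {d s} → Subset s → Vec (Z2^ d) s → Z2^ d
sumSel []             []       = 𝟘
sumSel (inside  ∷ S) (x ∷ xs) = x ⊕ sumSel S xs
sumSel (outside ∷ S) (x ∷ xs) = sumSel S xs

HasZeroSum : (m d s : ℕ) → Set
HasZeroSum m d s =
  (xs : Vec (Z2^ d) s) → Σ (Subset s) λ S → (∣ S ∣ ≡ 2 * m) × (sumSel S xs ≡ 𝟘)

IsS2m : (m d s : ℕ) → Set
IsS2m m d s = HasZeroSum m d s × (∀ t → HasZeroSum m d t → s ≤ t)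

{-# OPTIONS --safe #-}
-- Let F be the field with 2^K elements, written in coordinates over GF(2), and d = 1 + m K.
-- The 2 · 2^K vectors (b, t, t³, …, t^(2m−1)), b ∈ {0, 1}, t ∈ F, contain no 2m summing to 0
-- when m is odd. A zero-sum selection takes, for each t, none, one or both of its two vectors.
-- The t taken once form a set T with |T| + 2·#(pairs taken twice) = 2m, so |T| ≤ 2m is even and
-- p₀(T) = 0, where p_i(T) = Σ_{t ∈ T} t^i; the odd power sums p₁, p₃, …, p_{2m−1} vanish too,
-- hence all p_i with i < 2m vanish (p_{2i} = p_i² in characteristic 2), and Vandermonde gives
-- T = ∅. Then exactly m pairs are taken twice and the first coordinate sums to m ≡ 1 ≠ 0.
-- So s_{2m}(Z_2^d) > 2^(K+1), i.e. s^m ≥ 2^(d+m−1), for K = 2^j; these fields are obtained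
-- from GF(2) by iterated quadratic extensions y² + y + c.
module Submission where

open import Algebra.Bundles using (CommutativeSemiring; CommutativeRing)
import Algebra.Structures.Biased as Biased
open import Algebra.Solver.Ring.AlmostCommutativeRing
  using (fromCommutativeSemiring; _-Raw-AlmostCommutative⟶_)
open import Data.Bool as Bool using (Bool; true; false; not; _xor_; _∧_)
import Data.Bool.Properties as Bool
open import Data.Empty using (⊥-elim)
open import Data.Fin.Subset using (Subset; inside; outside; ∣_∣)
open import Data.List using (List; []; _∷_; length; map; cartesianProduct) renaming (_++_ to _++ˡ_)
import Data.List.Properties as List
open import Data.List.Relation.Binary.Sublist.Propositional using (_⊆_; []; _∷_; _∷ʳ_)
open import Data.List.Relation.Binary.Sublist.Propositional.Properties using (All-resp-⊆)
open import Data.List.Relation.Unary.All as All using (All; []; _∷_)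
open import Data.List.Relation.Unary.Unique.Propositional using (Unique; []; _∷_)
open import Data.List.Relation.Unary.Unique.Propositional.Properties using (cartesianProduct⁺)
import Data.Maybe as Maybe
open import Data.Nat as ℕ using (ℕ; zero; suc; _≤_; _<_; s≤s; z≤n)
open import Data.Nat.DivMod using (m≡m%n+[m/n]*n)
open import Data.Nat.Induction using (<-rec)
import Data.Nat.Properties as ℕ
open import Data.Product as Prod using (_,_; proj₁; proj₂)
import Data.Product.Properties as Prod
open import Data.Vec using (Vec; []; _∷_; _++_)
import Data.Vec.Properties as Vec
open import Function using (const; id; _∘_)
open import Level using (0ℓ)
open import Relation.Binary.Definitions using (DecidableEquality)
open import Relation.Binary.PropositionalEquality
open import Relation.Nullary using (¬_; yes; no; contradiction)
open import Relation.Nullary.Decidable using (dec⇒maybe)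

open import Defs

data EvenOrOdd : ℕ → Set where
  even : ∀ h → EvenOrOdd (h ℕ.* 2)
  odd  : ∀ h → EvenOrOdd (suc (h ℕ.* 2))

evenOrOdd : ∀ n → EvenOrOdd n
evenOrOdd zero = even 0
evenOrOdd (suc n) with evenOrOdd n
... | even h = odd h
... | odd  h = even (suc h)

m%2≡1⇒m≡1+[m/2]*2 : ∀ {m} → m ℕ.% 2 ≡ 1 → m ≡ 1 ℕ.+ m ℕ./ 2 ℕ.* 2
m%2≡1⇒m≡1+[m/2]*2 {m} m%2≡1 = trans (m≡m%n+[m/n]*n m 2) (cong (ℕ._+ m ℕ./ 2 ℕ.* 2) m%2≡1)

Unique-resp-⊆ : ∀ {A : Set} {xs ys : List A} → xs ⊆ ys → Unique ys → Unique xs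
Unique-resp-⊆ []             []                 = []
Unique-resp-⊆ (y ∷ʳ xs⊆ys)   (_ ∷ ys-unique)     = Unique-resp-⊆ xs⊆ys ys-unique
Unique-resp-⊆ (refl ∷ xs⊆ys) (y∉ys ∷ ys-unique) = All-resp-⊆ xs⊆ys y∉ys ∷ Unique-resp-⊆ xs⊆ys ys-unique

length-cartesianProduct : ∀ {A B : Set} (xs : List A) (ys : List B) →
                          length (cartesianProduct xs ys) ≡ length xs ℕ.* length ys
length-cartesianProduct []       ys = refl
length-cartesianProduct (x ∷ xs) ys = begin
  length (map (x ,_) ys ++ˡ cartesianProduct xs ys)          ≡⟨ List.length-++ (map (x ,_) ys) ⟩
  length (map (x ,_) ys) ℕ.+ length (cartesianProduct xs ys) ≡⟨ cong₂ ℕ._+_ (List.length-map (x ,_) ys)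
                                                                            (length-cartesianProduct xs ys) ⟩
  length ys ℕ.+ length xs ℕ.* length ys                      ∎
  where open ≡-Reasoning

⊕-self : ∀ {n} (x : Z2^ n) → x ⊕ x ≡ 𝟘
⊕-self []      = refl
⊕-self (b ∷ x) = cong₂ _∷_ (Bool.xor-same b) (⊕-self x)

⊕-cancelˡ : ∀ {n} (x y : Z2^ n) → x ⊕ (x ⊕ y) ≡ y
⊕-cancelˡ x y = begin
  x ⊕ (x ⊕ y)  ≡⟨ sym (Vec.zipWith-assoc Bool.xor-assoc x x y) ⟩
  (x ⊕ x) ⊕ y  ≡⟨ cong (_⊕ y) (⊕-self x) ⟩
  𝟘 ⊕ y        ≡⟨ Vec.zipWith-identityˡ Bool.xor-identityˡ y ⟩
  y            ∎
  where open ≡-Reasoning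

𝟘-++ : ∀ n {k} → 𝟘 {n ℕ.+ k} ≡ 𝟘 {n} ++ 𝟘 {k}
𝟘-++ zero    = refl
𝟘-++ (suc n) = cong (false ∷_) (𝟘-++ n)

-- Fields of characteristic 2

-- w * w + w ≢ c says that y² + y + c is irreducible; it is what lets the field be extended.
record Char2Field (A : Set) : Set where
  infixl 6 _+_
  infixl 7 _*_
  infix  8 _⁻¹
  field
    0# 1#       : A
    _+_ _*_     : A → A → A
    _⁻¹         : A → A
    _≟_         : DecidableEquality A
    +-assoc     : ∀ x y z → (x + y) + z ≡ x + (y + z)
    +-comm      : ∀ x y → x + y ≡ y + x
    +-identityˡ : ∀ x → 0# + x ≡ x
    x+x≡0       : ∀ x → x + x ≡ 0#
    *-assoc     : ∀ x y z → (x * y) * z ≡ x * (y * z)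
    *-comm      : ∀ x y → x * y ≡ y * x
    *-identityˡ : ∀ x → 1# * x ≡ x
    *-zeroˡ     : ∀ x → 0# * x ≡ 0#
    distribʳ    : ∀ x y z → (y + z) * x ≡ y * x + z * x
    *-inverseʳ  : ∀ x → x ≢ 0# → x * x ⁻¹ ≡ 1#
    1≢0         : 1# ≢ 0#
    c           : A
    w*w+w≢c     : ∀ w → w * w + w ≢ c

-- c = 1 works since w² + w = 0 for every w ∈ GF(2).
boolField : Char2Field Bool
boolField = record
  { 0#          = false
  ; 1#          = true
  ; _+_         = _xor_
  ; _*_         = _∧_
  ; _⁻¹         = const true
  ; _≟_         = Bool._≟_
  ; +-assoc     = Bool.xor-assoc
  ; +-comm      = Bool.xor-comm
  ; +-identityˡ = Bool.xor-identityˡ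
  ; x+x≡0       = Bool.xor-same
  ; *-assoc     = Bool.∧-assoc
  ; *-comm      = Bool.∧-comm
  ; *-identityˡ = Bool.∧-identityˡ
  ; *-zeroˡ     = Bool.∧-zeroˡ
  ; distribʳ    = Bool.∧-distribʳ-xor
  ; *-inverseʳ  = λ { false x≢0 → ⊥-elim (x≢0 refl) ; true _ → refl }
  ; 1≢0         = λ ()
  ; c           = true
  ; w*w+w≢c     = λ { false () ; true () }
  }

module Char2FieldProperties {A : Set} (F : Char2Field A) where
  open Char2Field F public
  open ≡-Reasoning

  commutativeSemiring : CommutativeSemiring 0ℓ 0ℓ
  commutativeSemiring = record
    { isCommutativeSemiring = Biased.isCommutativeSemiringˡ record
      { +-isCommutativeMonoid = Biased.isCommutativeMonoidˡ record
        { isSemigroup = record { isMagma = isMagma _+_ ; assoc = +-assoc }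
        ; identityˡ   = +-identityˡ
        ; comm        = +-comm
        }
      ; *-isCommutativeMonoid = Biased.isCommutativeMonoidˡ record
        { isSemigroup = record { isMagma = isMagma _*_ ; assoc = *-assoc }
        ; identityˡ   = *-identityˡ
        ; comm        = *-comm
        }
      ; distribʳ = distribʳ
      ; zeroˡ    = *-zeroˡ
      }
    }

  open CommutativeSemiring commutativeSemiring public
    using (+-identityʳ; *-identityʳ; zeroʳ; semiring)
  open import Algebra.Properties.Semiring.Exp semiring public using (_^_; ^-homo-*)
  open import Algebra.Properties.Semiring.Mult semiring public using (_×_; ×-homo-+)

  private
    𝔽₂-coefficients = CommutativeRing.rawRing Bool.xor-∧-commutativeRing

    fromBool : Bool → A
    fromBool false = 0#
    fromBool true  = 1#

    fromBool-homomorphism : 𝔽₂-coefficients -Raw-AlmostCommutative⟶ fromCommutativeSemiring commutativeSemiring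
    fromBool-homomorphism = record
      { ⟦_⟧    = fromBool
      ; +-homo = λ { false y     → sym (+-identityˡ (fromBool y))
                   ; true  false → sym (+-identityʳ 1#)
                   ; true  true  → sym (x+x≡0 1#) }
      ; *-homo = λ { false y → sym (*-zeroˡ (fromBool y))
                   ; true  y → sym (*-identityˡ (fromBool y)) }
      ; -‿homo = λ _ → refl
      ; 0-homo = refl
      ; 1-homo = refl
      }

    _≟-coefficient_ : ∀ x y → Maybe.Maybe (fromBool x ≡ fromBool y)
    x ≟-coefficient y = Maybe.map (cong fromBool) (dec⇒maybe (x Bool.≟ y))

  -- With coefficients in 𝔽₂ the solver also knows that x + x = 0.
  open import Algebra.Solver.Ring 𝔽₂-coefficients (fromCommutativeSemiring commutativeSemiring)
                                  fromBool-homomorphism _≟-coefficient_ public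
    using (Polynomial; solve; _:=_; _:+_; _:*_; con)

  x+y≡0⇒x≡y : ∀ {x y} → x + y ≡ 0# → x ≡ y
  x+y≡0⇒x≡y {x} {y} x+y≡0 = begin
    x            ≡⟨ solve 2 (λ x y → x := (x :+ y) :+ y) refl x y ⟩
    (x + y) + y  ≡⟨ cong (_+ y) x+y≡0 ⟩
    0# + y       ≡⟨ +-identityˡ y ⟩
    y            ∎

  x*y≡0⇒y≡0 : ∀ {x y} → x ≢ 0# → x * y ≡ 0# → y ≡ 0#
  x*y≡0⇒y≡0 {x} {y} x≢0 x*y≡0 = begin
    y                ≡⟨ sym (*-identityˡ y) ⟩
    1# * y           ≡⟨ cong (_* y) (sym (*-inverseʳ x x≢0)) ⟩
    (x * x ⁻¹) * y   ≡⟨ solve 3 (λ x x⁻¹ y → (x :* x⁻¹) :* y := x⁻¹ :* (x :* y)) refl x (x ⁻¹) y ⟩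
    x ⁻¹ * (x * y)   ≡⟨ cong (x ⁻¹ *_) x*y≡0 ⟩
    x ⁻¹ * 0#        ≡⟨ zeroʳ (x ⁻¹) ⟩
    0#               ∎

  x*y≡0⇒x≡0 : ∀ {x y} → y ≢ 0# → x * y ≡ 0# → x ≡ 0#
  x*y≡0⇒x≡0 {x} {y} y≢0 x*y≡0 = x*y≡0⇒y≡0 y≢0 (trans (*-comm y x) x*y≡0)

  x*x≡0⇒x≡0 : ∀ {x} → x * x ≡ 0# → x ≡ 0#
  x*x≡0⇒x≡0 {x} x*x≡0 with x ≟ 0#
  ... | yes x≡0 = x≡0
  ... | no  x≢0 = x*y≡0⇒y≡0 x≢0 x*x≡0

  [k*2]×x≡0 : ∀ k x → (k ℕ.* 2) × x ≡ 0#
  [k*2]×x≡0 zero    x = refl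
  [k*2]×x≡0 (suc k) x = begin
    x + (x + (k ℕ.* 2) × x)  ≡⟨ cong (λ y → x + (x + y)) ([k*2]×x≡0 k x) ⟩
    x + (x + 0#)             ≡⟨ cong (x +_) (+-identityʳ x) ⟩
    x + x                    ≡⟨ x+x≡0 x ⟩
    0#                       ∎

  [n+k*2]×x≡n×x : ∀ n k x → (n ℕ.+ k ℕ.* 2) × x ≡ n × x
  [n+k*2]×x≡n×x n k x = begin
    (n ℕ.+ k ℕ.* 2) × x      ≡⟨ ×-homo-+ x n (k ℕ.* 2) ⟩
    n × x + (k ℕ.* 2) × x    ≡⟨ cong (n × x +_) ([k*2]×x≡0 k x) ⟩
    n × x + 0#               ≡⟨ +-identityʳ (n × x) ⟩
    n × x                    ∎

  powerSum : (A → A) → List A → ℕ → A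
  powerSum w []       i = 0#
  powerSum w (t ∷ ts) i = w t * t ^ i + powerSum w ts i

  powerSum-zeroWeights : ∀ {w} ts i → All (λ t → w t ≡ 0#) ts → powerSum w ts i ≡ 0#
  powerSum-zeroWeights         []       i []            = refl
  powerSum-zeroWeights {w = w} (t ∷ ts) i (wt≡0 ∷ w≡0) = begin
    w t * t ^ i + powerSum w ts i  ≡⟨ cong₂ _+_ (cong (_* t ^ i) wt≡0) (powerSum-zeroWeights ts i w≡0) ⟩
    0# * t ^ i + 0#                ≡⟨ cong (_+ 0#) (*-zeroˡ (t ^ i)) ⟩
    0# + 0#                        ≡⟨ +-identityˡ 0# ⟩
    0#                             ∎

  powerSum-shift : ∀ w t₀ ts i →
                   powerSum (λ t → w t * (t + t₀)) ts i ≡ powerSum w ts (suc i) + t₀ * powerSum w ts i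
  powerSum-shift w t₀ []       i = sym (trans (+-identityˡ (t₀ * 0#)) (zeroʳ t₀))
  powerSum-shift w t₀ (t ∷ ts) i = begin
    w t * (t + t₀) * t ^ i + powerSum (λ t → w t * (t + t₀)) ts i
      ≡⟨ cong (w t * (t + t₀) * t ^ i +_) (powerSum-shift w t₀ ts i) ⟩
    w t * (t + t₀) * t ^ i + (powerSum w ts (suc i) + t₀ * powerSum w ts i)
      ≡⟨ solve 6 (λ W T T₀ X P₁ P₀ → W :* (T :+ T₀) :* X :+ (P₁ :+ T₀ :* P₀)
                                   := (W :* (T :* X) :+ P₁) :+ T₀ :* (W :* X :+ P₀))
               refl (w t) t t₀ (t ^ i) (powerSum w ts (suc i)) (powerSum w ts i) ⟩
    (w t * t ^ suc i + powerSum w ts (suc i)) + t₀ * (w t * t ^ i + powerSum w ts i)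
      ∎

  -- Vandermonde: multiplying the weights by t + t₀ kills the node t₀ and shifts the power sums.
  powerSums≡0⇒weights≡0 : ∀ {w} n ts → length ts ≤ n → Unique ts →
                          (∀ i → i < n → powerSum w ts i ≡ 0#) → All (λ t → w t ≡ 0#) ts
  powerSums≡0⇒weights≡0         n       []        _            _                   _      = []
  powerSums≡0⇒weights≡0 {w = w} (suc n) (t₀ ∷ ts) (s≤s |ts|≤n) (t₀∉ts ∷ ts-unique) sums≡0 = wt₀≡0 ∷ w≡0
    where
    sums-ts : ∀ i → i < suc n → powerSum w ts i ≡ w t₀ * t₀ ^ i
    sums-ts i i<1+n = sym (x+y≡0⇒x≡y (sums≡0 i i<1+n))

    shifted≡0 : ∀ i → i < n → powerSum (λ t → w t * (t + t₀)) ts i ≡ 0#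
    shifted≡0 i i<n = begin
      powerSum (λ t → w t * (t + t₀)) ts i          ≡⟨ powerSum-shift w t₀ ts i ⟩
      powerSum w ts (suc i) + t₀ * powerSum w ts i  ≡⟨ cong₂ (λ x y → x + t₀ * y) (sums-ts (suc i) (s≤s i<n))
                                                                                 (sums-ts i (ℕ.m<n⇒m<1+n i<n)) ⟩
      w t₀ * (t₀ * t₀ ^ i) + t₀ * (w t₀ * t₀ ^ i)   ≡⟨ solve 3 (λ W T X → W :* (T :* X) :+ T :* (W :* X) := con false)
                                                              refl (w t₀) t₀ (t₀ ^ i) ⟩
      0#                                            ∎

    cancel : ∀ {t} → w t * (t + t₀) ≡ 0# Prod.× t₀ ≢ t → w t ≡ 0#
    cancel (wt*[t+t₀]≡0 , t₀≢t) = x*y≡0⇒x≡0 (λ t+t₀≡0 → t₀≢t (sym (x+y≡0⇒x≡y t+t₀≡0))) wt*[t+t₀]≡0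

    w≡0 : All (λ t → w t ≡ 0#) ts
    w≡0 = All.zipWith cancel (powerSums≡0⇒weights≡0 n ts |ts|≤n ts-unique shifted≡0 , t₀∉ts)

    wt₀≡0 : w t₀ ≡ 0#
    wt₀≡0 = begin
      w t₀             ≡⟨ sym (*-identityʳ (w t₀)) ⟩
      w t₀ * 1#        ≡⟨ x+y≡0⇒x≡y (sums≡0 0 ℕ.z<s) ⟩
      powerSum w ts 0  ≡⟨ powerSum-zeroWeights ts 0 w≡0 ⟩
      0#               ∎

  distinct-powerSums≡0⇒[] : ∀ n ts → length ts ≤ n → Unique ts →
                            (∀ i → i < n → powerSum (const 1#) ts i ≡ 0#) → ts ≡ []
  distinct-powerSums≡0⇒[] n []       _      _      _      = refl
  distinct-powerSums≡0⇒[] n (t ∷ ts) |ts|≤n unique sums≡0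
    with powerSums≡0⇒weights≡0 n (t ∷ ts) |ts|≤n unique sums≡0
  ... | 1≡0 ∷ _ = ⊥-elim (1≢0 1≡0)

  powerSum-∷ : ∀ t ts i → t ^ i + powerSum (const 1#) ts i ≡ powerSum (const 1#) (t ∷ ts) i
  powerSum-∷ t ts i = cong (_+ powerSum (const 1#) ts i) (sym (*-identityˡ (t ^ i)))

  powerSum-0 : ∀ ts → powerSum (const 1#) ts 0 ≡ length ts × 1#
  powerSum-0 []       = refl
  powerSum-0 (t ∷ ts) = cong₂ _+_ (*-identityˡ 1#) (powerSum-0 ts)

  powerSum-[i*2] : ∀ ts i →
                   powerSum (const 1#) ts (i ℕ.* 2) ≡ powerSum (const 1#) ts i * powerSum (const 1#) ts i
  powerSum-[i*2] []       i = sym (*-zeroˡ 0#)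
  powerSum-[i*2] (t ∷ ts) i = begin
    1# * t ^ (i ℕ.* 2) + powerSum (const 1#) ts (i ℕ.* 2)  ≡⟨ cong₂ (λ x y → 1# * x + y) t^[i*2]≡t^i*t^i
                                                                                        (powerSum-[i*2] ts i) ⟩
    1# * (t ^ i * t ^ i) + P * P                           ≡⟨ solve 2 (λ X P → con true :* (X :* X) :+ P :* P
                                                                              := (con true :* X :+ P) :* (con true :* X :+ P))
                                                                     refl (t ^ i) P ⟩
    (1# * t ^ i + P) * (1# * t ^ i + P)                    ∎
    where
    P : A
    P = powerSum (const 1#) ts i

    t^[i*2]≡t^i*t^i : t ^ (i ℕ.* 2) ≡ t ^ i * t ^ i
    t^[i*2]≡t^i*t^i = trans (cong (t ^_) (trans (ℕ.*-comm i 2) (cong (i ℕ.+_) (ℕ.+-identityʳ i)))) (^-homo-* t i i)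

  oddPowerSums≡0⇒powerSums≡0 : ∀ ts n → powerSum (const 1#) ts 0 ≡ 0# →
                               (∀ h → h < n → powerSum (const 1#) ts (suc (h ℕ.* 2)) ≡ 0#) →
                               ∀ i → i < n ℕ.* 2 → powerSum (const 1#) ts i ≡ 0#
  oddPowerSums≡0⇒powerSums≡0 ts n p₀≡0 odd≡0 = <-rec (λ i → i < n ℕ.* 2 → p i ≡ 0#) step
    where
    p : ℕ → A
    p = powerSum (const 1#) ts

    step : ∀ i → (∀ {j} → j < i → j < n ℕ.* 2 → p j ≡ 0#) → i < n ℕ.* 2 → p i ≡ 0#
    step i rec i<2n with evenOrOdd i
    ... | even zero    = p₀≡0
    ... | even (suc h) = begin
      p (suc h ℕ.* 2)       ≡⟨ powerSum-[i*2] ts (suc h) ⟩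
      p (suc h) * p (suc h) ≡⟨ cong (λ x → x * x) (rec h<i (ℕ.<-trans h<i i<2n)) ⟩
      0# * 0#               ≡⟨ *-zeroˡ 0# ⟩
      0#                    ∎
      where
      h<i : suc h < suc h ℕ.* 2
      h<i = ℕ.m<m*n (suc h) 2 (s≤s (s≤s z≤n))
    ... | odd h = odd≡0 h (ℕ.*-cancelʳ-< 2 h n (ℕ.<-trans (ℕ.n<1+n (h ℕ.* 2)) i<2n))

-- (u , v) stands for u + v y, where y² = y + c.
module QuadraticExtension {A : Set} (F : Char2Field A) where
  open Char2FieldProperties F
  open ≡-Reasoning

  infixl 6 _+ᴱ_
  infixl 7 _*ᴱ_
  infix  8 _⁻¹ᴱ

  E : Set
  E = A Prod.× A

  _+ᴱ_ : E → E → E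
  (u , v) +ᴱ (u′ , v′) = (u + u′ , v + v′)

  _*ᴱ_ : E → E → E
  (u , v) *ᴱ (u′ , v′) = (u * u′ + v * v′ * c , u * v′ + v * u′ + v * v′)

  -- The product of u + v y with its conjugate (u + v) + v y: the other root of y² + y + c is y + 1.
  norm : E → A
  norm (u , v) = u * u + u * v + v * v * c

  _⁻¹ᴱ : E → E
  (u , v) ⁻¹ᴱ = ((u + v) * norm (u , v) ⁻¹ , v * norm (u , v) ⁻¹)

  -- _*ᴱ_ on solver expressions, so that the ring laws of E can be solved componentwise.
  private
    Polynomial² : ℕ → Set
    Polynomial² n = Polynomial n Prod.× Polynomial n

    mulᴾ : ∀ {n} → Polynomial n → Polynomial² n → Polynomial² n → Polynomial² n
    mulᴾ c (u , v) (u′ , v′) = (u :* u′ :+ v :* v′ :* c , u :* v′ :+ v :* u′ :+ v :* v′)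

    addᴾ : ∀ {n} → Polynomial² n → Polynomial² n → Polynomial² n
    addᴾ (u , v) (u′ , v′) = (u :+ u′ , v :+ v′)

  *ᴱ-assoc : ∀ x y z → (x *ᴱ y) *ᴱ z ≡ x *ᴱ (y *ᴱ z)
  *ᴱ-assoc (u , v) (u′ , v′) (u″ , v″) = cong₂ _,_
    (solve 7 (λ u v u′ v′ u″ v″ c → proj₁ (mulᴾ c (mulᴾ c (u , v) (u′ , v′)) (u″ , v″))
                                  := proj₁ (mulᴾ c (u , v) (mulᴾ c (u′ , v′) (u″ , v″)))) refl u v u′ v′ u″ v″ c)
    (solve 7 (λ u v u′ v′ u″ v″ c → proj₂ (mulᴾ c (mulᴾ c (u , v) (u′ , v′)) (u″ , v″))
                                  := proj₂ (mulᴾ c (u , v) (mulᴾ c (u′ , v′) (u″ , v″)))) refl u v u′ v′ u″ v″ c)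

  *ᴱ-comm : ∀ x y → x *ᴱ y ≡ y *ᴱ x
  *ᴱ-comm (u , v) (u′ , v′) = cong₂ _,_
    (solve 5 (λ u v u′ v′ c → proj₁ (mulᴾ c (u , v) (u′ , v′)) := proj₁ (mulᴾ c (u′ , v′) (u , v))) refl u v u′ v′ c)
    (solve 5 (λ u v u′ v′ c → proj₂ (mulᴾ c (u , v) (u′ , v′)) := proj₂ (mulᴾ c (u′ , v′) (u , v))) refl u v u′ v′ c)

  *ᴱ-identityˡ : ∀ x → (1# , 0#) *ᴱ x ≡ x
  *ᴱ-identityˡ (u , v) = cong₂ _,_
    (solve 3 (λ u v c → proj₁ (mulᴾ c (con true , con false) (u , v)) := u) refl u v c)
    (solve 3 (λ u v c → proj₂ (mulᴾ c (con true , con false) (u , v)) := v) refl u v c)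

  *ᴱ-zeroˡ : ∀ x → (0# , 0#) *ᴱ x ≡ (0# , 0#)
  *ᴱ-zeroˡ (u , v) = cong₂ _,_
    (solve 3 (λ u v c → proj₁ (mulᴾ c (con false , con false) (u , v)) := con false) refl u v c)
    (solve 3 (λ u v c → proj₂ (mulᴾ c (con false , con false) (u , v)) := con false) refl u v c)

  distribʳᴱ : ∀ x y z → (y +ᴱ z) *ᴱ x ≡ y *ᴱ x +ᴱ z *ᴱ x
  distribʳᴱ (u , v) (u′ , v′) (u″ , v″) = cong₂ _,_
    (solve 7 (λ u v u′ v′ u″ v″ c → proj₁ (mulᴾ c (addᴾ (u′ , v′) (u″ , v″)) (u , v))
                                  := proj₁ (addᴾ (mulᴾ c (u′ , v′) (u , v)) (mulᴾ c (u″ , v″) (u , v))))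
             refl u v u′ v′ u″ v″ c)
    (solve 7 (λ u v u′ v′ u″ v″ c → proj₂ (mulᴾ c (addᴾ (u′ , v′) (u″ , v″)) (u , v))
                                  := proj₂ (addᴾ (mulᴾ c (u′ , v′) (u , v)) (mulᴾ c (u″ , v″) (u , v))))
             refl u v u′ v′ u″ v″ c)

  norm≡0⇒≡0 : ∀ u v → norm (u , v) ≡ 0# → (u , v) ≡ (0# , 0#)
  norm≡0⇒≡0 u v norm≡0 with v ≟ 0#
  ... | yes refl = cong (_, 0#) (x*x≡0⇒x≡0 (trans u*u≡norm norm≡0))
    where
    u*u≡norm : u * u ≡ norm (u , 0#)
    u*u≡norm = solve 2 (λ u c → u :* u := u :* u :+ u :* con false :+ con false :* con false :* c) refl u c
  ... | no v≢0 = ⊥-elim (w*w+w≢c w (x+y≡0⇒x≡y w*w+w+c≡0))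
    where
    -- Dividing the norm by v² gives w² + w + c for w = u / v.
    w : A
    w = u * v ⁻¹

    w*w+w+c≡0 : w * w + w + c ≡ 0#
    w*w+w+c≡0 = begin
      w * w + w + c
        ≡⟨ solve 2 (λ w c → w :* w :+ w :+ c := w :* w :+ w :* con true :+ con true :* con true :* c) refl w c ⟩
      w * w + w * 1# + 1# * 1# * c
        ≡⟨ cong (λ x → w * w + w * x + x * x * c) (sym (*-inverseʳ v v≢0)) ⟩
      w * w + w * (v * v ⁻¹) + (v * v ⁻¹) * (v * v ⁻¹) * c
        ≡⟨ solve 4 (λ u v i c → (u :* i) :* (u :* i) :+ (u :* i) :* (v :* i) :+ (v :* i) :* (v :* i) :* c
                              := i :* i :* (u :* u :+ u :* v :+ v :* v :* c)) refl u v (v ⁻¹) c ⟩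
      v ⁻¹ * v ⁻¹ * norm (u , v)
        ≡⟨ cong (v ⁻¹ * v ⁻¹ *_) norm≡0 ⟩
      v ⁻¹ * v ⁻¹ * 0#
        ≡⟨ zeroʳ (v ⁻¹ * v ⁻¹) ⟩
      0#
        ∎

  *ᴱ-inverseʳ : ∀ x → x ≢ (0# , 0#) → x *ᴱ x ⁻¹ᴱ ≡ (1# , 0#)
  *ᴱ-inverseʳ (u , v) x≢0 = cong₂ _,_
    (trans (solve 4 (λ u v n c → u :* ((u :+ v) :* n) :+ v :* (v :* n) :* c
                               := (u :* u :+ u :* v :+ v :* v :* c) :* n)
                    refl u v (norm (u , v) ⁻¹) c)
           (*-inverseʳ (norm (u , v)) (x≢0 ∘ norm≡0⇒≡0 u v)))
    (solve 3 (λ u v n → u :* (v :* n) :+ v :* ((u :+ v) :* n) :+ v :* (v :* n) := con false)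
           refl u v (norm (u , v) ⁻¹))

  v*v+v≡proj₂[x*x+x] : ∀ u v → v * v + v ≡ proj₂ ((u , v) *ᴱ (u , v) +ᴱ (u , v))
  v*v+v≡proj₂[x*x+x] u v = solve 2 (λ u v → v :* v :+ v := u :* v :+ v :* u :+ v :* v :+ v) refl u v

  quadraticExtension : Char2Field E
  quadraticExtension = record
    { 0#          = 0# , 0#
    ; 1#          = 1# , 0#
    ; _+_         = _+ᴱ_
    ; _*_         = _*ᴱ_
    ; _⁻¹         = _⁻¹ᴱ
    ; _≟_         = Prod.≡-dec _≟_ _≟_
    ; +-assoc     = λ (u , v) (u′ , v′) (u″ , v″) → cong₂ _,_ (+-assoc u u′ u″) (+-assoc v v′ v″)
    ; +-comm      = λ (u , v) (u′ , v′) → cong₂ _,_ (+-comm u u′) (+-comm v v′)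
    ; +-identityˡ = λ (u , v) → cong₂ _,_ (+-identityˡ u) (+-identityˡ v)
    ; x+x≡0       = λ (u , v) → cong₂ _,_ (x+x≡0 u) (x+x≡0 v)
    ; *-assoc     = *ᴱ-assoc
    ; *-comm      = *ᴱ-comm
    ; *-identityˡ = *ᴱ-identityˡ
    ; *-zeroˡ     = *ᴱ-zeroˡ
    ; distribʳ    = distribʳᴱ
    ; *-inverseʳ  = *ᴱ-inverseʳ
    ; 1≢0         = 1≢0 ∘ cong proj₁
    ; c           = 0# , c
    ; w*w+w≢c     = λ (u , v) → w*w+w≢c v ∘ trans (v*v+v≡proj₂[x*x+x] u v) ∘ cong proj₂
    }

-- A zero-sum-free sequence

module PairedOddPowers {A : Set} (F : Char2Field A) where
  open Char2FieldProperties F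
  private module 𝔽₂ = Char2FieldProperties boolField
  open ≡-Reasoning

  module _ {K : ℕ} (coords : A → Z2^ K)
                   (coords-+ : ∀ x y → coords (x + y) ≡ coords x ⊕ coords y)
                   (coords≡𝟘⇒≡0 : ∀ x → coords x ≡ 𝟘 → x ≡ 0#)
                   (m : ℕ) where

    coords-0 : coords 0# ≡ 𝟘
    coords-0 = begin
      coords 0#              ≡⟨ cong coords (sym (+-identityˡ 0#)) ⟩
      coords (0# + 0#)       ≡⟨ coords-+ 0# 0# ⟩
      coords 0# ⊕ coords 0#  ≡⟨ ⊕-self (coords 0#) ⟩
      𝟘                      ∎

    powerCoords : (ℕ → A) → (r : ℕ) → Z2^ (r ℕ.* K)
    powerCoords f zero    = []
    powerCoords f (suc r) = coords (f 0) ++ powerCoords (f ∘ (2 ℕ.+_)) r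

    powerCoords-+ : ∀ r {f g h} → (∀ i → f i + g i ≡ h i) → powerCoords f r ⊕ powerCoords g r ≡ powerCoords h r
    powerCoords-+ zero    _ = refl
    powerCoords-+ (suc r) {f} {g} {h} f+g≡h = begin
      (coords (f 0) ++ powerCoords (f ∘ (2 ℕ.+_)) r) ⊕ (coords (g 0) ++ powerCoords (g ∘ (2 ℕ.+_)) r)
        ≡⟨ Vec.zipWith-++ _xor_ (coords (f 0)) (powerCoords (f ∘ (2 ℕ.+_)) r) (coords (g 0)) (powerCoords (g ∘ (2 ℕ.+_)) r) ⟩
      (coords (f 0) ⊕ coords (g 0)) ++ (powerCoords (f ∘ (2 ℕ.+_)) r ⊕ powerCoords (g ∘ (2 ℕ.+_)) r)
        ≡⟨ cong₂ _++_ (trans (sym (coords-+ (f 0) (g 0))) (cong coords (f+g≡h 0)))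
                      (powerCoords-+ r (f+g≡h ∘ (2 ℕ.+_))) ⟩
      coords (h 0) ++ powerCoords (h ∘ (2 ℕ.+_)) r
        ∎

    powerCoords-0 : ∀ r → powerCoords (const 0#) r ≡ 𝟘
    powerCoords-0 zero    = refl
    powerCoords-0 (suc r) = trans (cong₂ _++_ coords-0 (powerCoords-0 r)) (sym (𝟘-++ K))

    powerCoords≡𝟘 : ∀ r f → powerCoords f r ≡ 𝟘 → ∀ h → h < r → f (h ℕ.* 2) ≡ 0#
    powerCoords≡𝟘 (suc r) f ≡𝟘 zero    _         =
      coords≡𝟘⇒≡0 (f 0) (Vec.++-injectiveˡ (coords (f 0)) 𝟘 (trans ≡𝟘 (𝟘-++ K)))
    powerCoords≡𝟘 (suc r) f ≡𝟘 (suc h) (s≤s h<r) =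
      powerCoords≡𝟘 r (f ∘ (2 ℕ.+_)) (Vec.++-injectiveʳ (coords (f 0)) 𝟘 (trans ≡𝟘 (𝟘-++ K))) h h<r

    -- ψ b t = (b, t, t³, …, t^(2m−1)).
    ψ : Bool → A → Z2^ (suc (m ℕ.* K))
    ψ b t = b ∷ powerCoords (λ i → t ^ suc i) m

    pairedSequence : (ts : List A) → Vec (Z2^ (suc (m ℕ.* K))) (length ts ℕ.* 2)
    pairedSequence []       = []
    pairedSequence (t ∷ ts) = ψ false t ∷ ψ true t ∷ pairedSequence ts

    singles : (ts : List A) → Subset (length ts ℕ.* 2) → List A
    singles []       []                      = []
    singles (t ∷ ts) (inside  ∷ inside  ∷ S) = singles ts S
    singles (t ∷ ts) (inside  ∷ outside ∷ S) = t ∷ singles ts S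
    singles (t ∷ ts) (outside ∷ inside  ∷ S) = t ∷ singles ts S
    singles (t ∷ ts) (outside ∷ outside ∷ S) = singles ts S

    doubles : (ts : List A) → Subset (length ts ℕ.* 2) → ℕ
    doubles []       []                      = 0
    doubles (t ∷ ts) (inside  ∷ inside  ∷ S) = suc (doubles ts S)
    doubles (t ∷ ts) (inside  ∷ outside ∷ S) = doubles ts S
    doubles (t ∷ ts) (outside ∷ inside  ∷ S) = doubles ts S
    doubles (t ∷ ts) (outside ∷ outside ∷ S) = doubles ts S

    bit : (ts : List A) → Subset (length ts ℕ.* 2) → Bool
    bit []       []                      = false
    bit (t ∷ ts) (inside  ∷ inside  ∷ S) = not (bit ts S)
    bit (t ∷ ts) (inside  ∷ outside ∷ S) = bit ts S
    bit (t ∷ ts) (outside ∷ inside  ∷ S) = not (bit ts S)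
    bit (t ∷ ts) (outside ∷ outside ∷ S) = bit ts S

    ∣S∣≡singles+doubles*2 : ∀ ts S → ∣ S ∣ ≡ length (singles ts S) ℕ.+ doubles ts S ℕ.* 2
    ∣S∣≡singles+doubles*2 []       []                      = refl
    ∣S∣≡singles+doubles*2 (t ∷ ts) (inside  ∷ inside  ∷ S) = begin
      suc (suc ∣ S ∣)            ≡⟨ cong (suc ∘ suc) (∣S∣≡singles+doubles*2 ts S) ⟩
      suc (suc (l ℕ.+ d ℕ.* 2))  ≡⟨ cong suc (sym (ℕ.+-suc l (d ℕ.* 2))) ⟩
      suc (l ℕ.+ suc (d ℕ.* 2))  ≡⟨ sym (ℕ.+-suc l (suc (d ℕ.* 2))) ⟩
      l ℕ.+ suc d ℕ.* 2          ∎
      where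
      l d : ℕ
      l = length (singles ts S)
      d = doubles ts S
    ∣S∣≡singles+doubles*2 (t ∷ ts) (inside  ∷ outside ∷ S) = cong suc (∣S∣≡singles+doubles*2 ts S)
    ∣S∣≡singles+doubles*2 (t ∷ ts) (outside ∷ inside  ∷ S) = cong suc (∣S∣≡singles+doubles*2 ts S)
    ∣S∣≡singles+doubles*2 (t ∷ ts) (outside ∷ outside ∷ S) = ∣S∣≡singles+doubles*2 ts S

    singles⊆ : ∀ ts S → singles ts S ⊆ ts
    singles⊆ []       []                      = []
    singles⊆ (t ∷ ts) (inside  ∷ inside  ∷ S) = t ∷ʳ singles⊆ ts S
    singles⊆ (t ∷ ts) (inside  ∷ outside ∷ S) = refl ∷ singles⊆ ts S
    singles⊆ (t ∷ ts) (outside ∷ inside  ∷ S) = refl ∷ singles⊆ ts S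
    singles⊆ (t ∷ ts) (outside ∷ outside ∷ S) = t ∷ʳ singles⊆ ts S

    bit-noSingles : ∀ ts S → singles ts S ≡ [] → bit ts S ≡ doubles ts S 𝔽₂.× true
    bit-noSingles []       []                      _   = refl
    bit-noSingles (t ∷ ts) (inside  ∷ inside  ∷ S) ≡[] = cong not (bit-noSingles ts S ≡[])
    bit-noSingles (t ∷ ts) (outside ∷ outside ∷ S) ≡[] = bit-noSingles ts S ≡[]

    sumSel≡bit∷oddPowerSums : ∀ ts S →
      sumSel S (pairedSequence ts) ≡ bit ts S ∷ powerCoords (λ i → powerSum (const 1#) (singles ts S) (suc i)) m
    sumSel≡bit∷oddPowerSums []       []                      = cong (false ∷_) (sym (powerCoords-0 m))
    sumSel≡bit∷oddPowerSums (t ∷ ts) (inside  ∷ inside  ∷ S) rewrite sumSel≡bit∷oddPowerSums ts S =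
      cong (not (bit ts S) ∷_) (⊕-cancelˡ (powerCoords (λ i → t ^ suc i) m) _)
    sumSel≡bit∷oddPowerSums (t ∷ ts) (inside  ∷ outside ∷ S) rewrite sumSel≡bit∷oddPowerSums ts S =
      cong (bit ts S ∷_) (powerCoords-+ m (powerSum-∷ t (singles ts S) ∘ suc))
    sumSel≡bit∷oddPowerSums (t ∷ ts) (outside ∷ inside  ∷ S) rewrite sumSel≡bit∷oddPowerSums ts S =
      cong (not (bit ts S) ∷_) (powerCoords-+ m (powerSum-∷ t (singles ts S) ∘ suc))
    sumSel≡bit∷oddPowerSums (t ∷ ts) (outside ∷ outside ∷ S) = sumSel≡bit∷oddPowerSums ts S

    ¬HasZeroSum : m ℕ.% 2 ≡ 1 → ∀ ts → Unique ts → ¬ HasZeroSum m (suc (m ℕ.* K)) (length ts ℕ.* 2)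
    ¬HasZeroSum m-odd ts ts-unique hasZeroSum with hasZeroSum (pairedSequence ts)
    ... | S , ∣S∣≡2m , sum≡𝟘 = contradiction (trans (sym bit≡false) bit≡true) λ ()
      where
      T : List A
      T = singles ts S

      P : ℕ
      P = doubles ts S

      card : length T ℕ.+ P ℕ.* 2 ≡ m ℕ.* 2
      card = trans (sym (∣S∣≡singles+doubles*2 ts S)) (trans ∣S∣≡2m (ℕ.*-comm 2 m))

      bit∷oddPowerSums≡𝟘 : bit ts S ∷ powerCoords (λ i → powerSum (const 1#) T (suc i)) m ≡ 𝟘
      bit∷oddPowerSums≡𝟘 = trans (sym (sumSel≡bit∷oddPowerSums ts S)) sum≡𝟘

      bit≡false : bit ts S ≡ false
      bit≡false = Vec.∷-injectiveˡ bit∷oddPowerSums≡𝟘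

      p₀≡0 : powerSum (const 1#) T 0 ≡ 0#
      p₀≡0 = begin
        powerSum (const 1#) T 0      ≡⟨ powerSum-0 T ⟩
        length T × 1#                ≡⟨ sym ([n+k*2]×x≡n×x (length T) P 1#) ⟩
        (length T ℕ.+ P ℕ.* 2) × 1#  ≡⟨ cong (_× 1#) card ⟩
        (m ℕ.* 2) × 1#               ≡⟨ [k*2]×x≡0 m 1# ⟩
        0#                           ∎

      T≡[] : T ≡ []
      T≡[] = distinct-powerSums≡0⇒[] (m ℕ.* 2) T
        (subst (length T ≤_) card (ℕ.m≤m+n (length T) (P ℕ.* 2)))
        (Unique-resp-⊆ (singles⊆ ts S) ts-unique)
        (oddPowerSums≡0⇒powerSums≡0 T m p₀≡0 (powerCoords≡𝟘 m _ (Vec.∷-injectiveʳ bit∷oddPowerSums≡𝟘)))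

      P≡m : P ≡ m
      P≡m = ℕ.*-cancelʳ-≡ P m 2 (subst (λ T → length T ℕ.+ P ℕ.* 2 ≡ m ℕ.* 2) T≡[] card)

      bit≡true : bit ts S ≡ true
      bit≡true = begin
        bit ts S                         ≡⟨ bit-noSingles ts S T≡[] ⟩
        P 𝔽₂.× true                      ≡⟨ cong (𝔽₂._× true) (trans P≡m (m%2≡1⇒m≡1+[m/2]*2 m-odd)) ⟩
        (1 ℕ.+ m ℕ./ 2 ℕ.* 2) 𝔽₂.× true  ≡⟨ 𝔽₂.[n+k*2]×x≡n×x 1 (m ℕ./ 2) true ⟩
        true                             ∎

-- Opened only now: above, these symbols denote field operations.
open import Data.Nat using (_+_; _*_; _^_; _∸_; _%_)
open import Data.Product using (Σ; _×_)

-- The tower GF(2) ⊂ GF(4) ⊂ GF(16) ⊂ …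

𝔽 : ℕ → Set
𝔽 zero    = Bool
𝔽 (suc j) = 𝔽 j × 𝔽 j

𝔽-field : ∀ j → Char2Field (𝔽 j)
𝔽-field zero    = boolField
𝔽-field (suc j) = QuadraticExtension.quadraticExtension (𝔽-field j)

degree : ℕ → ℕ
degree zero    = 1
degree (suc j) = degree j + degree j

j<degree : ∀ j → j < degree j
j<degree zero    = ℕ.z<s
j<degree (suc j) = ℕ.+-mono-≤ (ℕ.≤-trans (s≤s z≤n) (j<degree j)) (j<degree j)

coords : ∀ j → 𝔽 j → Z2^ (degree j)
coords zero    b       = b ∷ []
coords (suc j) (u , v) = coords j u ++ coords j v

coords-+ : ∀ j x y → coords j (Char2Field._+_ (𝔽-field j) x y) ≡ coords j x ⊕ coords j y
coords-+ zero    x       y         = refl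
coords-+ (suc j) (u , v) (u′ , v′) =
  trans (cong₂ _++_ (coords-+ j u u′) (coords-+ j v v′))
        (sym (Vec.zipWith-++ _xor_ (coords j u) (coords j v) (coords j u′) (coords j v′)))

coords≡𝟘⇒≡0 : ∀ j x → coords j x ≡ 𝟘 → x ≡ Char2Field.0# (𝔽-field j)
coords≡𝟘⇒≡0 zero    b       ≡𝟘 = Vec.∷-injectiveˡ ≡𝟘
coords≡𝟘⇒≡0 (suc j) (u , v) ≡𝟘 = cong₂ _,_
  (coords≡𝟘⇒≡0 j u (Vec.++-injectiveˡ (coords j u) 𝟘 ≡𝟘++𝟘))
  (coords≡𝟘⇒≡0 j v (Vec.++-injectiveʳ (coords j u) 𝟘 ≡𝟘++𝟘))
  where
  ≡𝟘++𝟘 : coords j u ++ coords j v ≡ 𝟘 {degree j} ++ 𝟘 {degree j}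
  ≡𝟘++𝟘 = trans ≡𝟘 (𝟘-++ (degree j))

elements : ∀ j → List (𝔽 j)
elements zero    = false ∷ true ∷ []
elements (suc j) = cartesianProduct (elements j) (elements j)

elements-unique : ∀ j → Unique (elements j)
elements-unique zero    = ((λ ()) ∷ []) ∷ [] ∷ []
elements-unique (suc j) = cartesianProduct⁺ (elements-unique j) (elements-unique j)

length-elements : ∀ j → length (elements j) ≡ 2 ^ degree j
length-elements zero    = refl
length-elements (suc j) = begin
  length (cartesianProduct (elements j) (elements j))  ≡⟨ length-cartesianProduct (elements j) (elements j) ⟩
  length (elements j) * length (elements j)          ≡⟨ cong₂ _*_ (length-elements j) (length-elements j) ⟩
  2 ^ degree j * 2 ^ degree j                    ≡⟨ sym (ℕ.^-distribˡ-+-* 2 (degree j) (degree j)) ⟩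
  2 ^ (degree j + degree j)                        ∎
  where open ≡-Reasoning

HasZeroSum-suc : ∀ {m d s} → HasZeroSum m d s → HasZeroSum m d (suc s)
HasZeroSum-suc hasZeroSum (x ∷ xs) =
  let S , ∣S∣≡2m , sum≡𝟘 = hasZeroSum xs in (outside ∷ S) , ∣S∣≡2m , sum≡𝟘

HasZeroSum-mono : ∀ {m d s t} → s ≤ t → HasZeroSum m d s → HasZeroSum m d t
HasZeroSum-mono {m} {d} {s} s≤t = mono (ℕ.≤⇒≤′ s≤t)
  where
  mono : ∀ {t} → s ℕ.≤′ t → HasZeroSum m d s → HasZeroSum m d t
  mono ℕ.≤′-refl        = id
  mono (ℕ.≤′-step s≤′t) = HasZeroSum-suc {m} {d} ∘ mono s≤′t

2^[degree+1]<s : ∀ {m} → m % 2 ≡ 1 → ∀ j {s} → HasZeroSum m (suc (m * degree j)) s → 2 ^ suc (degree j) < s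
2^[degree+1]<s {m} m-odd j {s} hasZeroSum = ℕ.≰⇒> λ s≤2^[K+1] →
  PairedOddPowers.¬HasZeroSum (𝔽-field j) (coords j) (coords-+ j) (coords≡𝟘⇒≡0 j) m m-odd
    (elements j) (elements-unique j)
    (HasZeroSum-mono {m} {suc (m * degree j)} (subst (s ≤_) 2^[K+1]≡|elements|*2 s≤2^[K+1]) hasZeroSum)
  where
  2^[K+1]≡|elements|*2 : 2 ^ suc (degree j) ≡ length (elements j) * 2
  2^[K+1]≡|elements|*2 = trans (ℕ.*-comm 2 (2 ^ degree j)) (cong (_* 2) (sym (length-elements j)))

2^[m*K+m]≡[2^[K+1]]^m : ∀ m K → 2 ^ (m * K + m) ≡ (2 ^ suc K) ^ m
2^[m*K+m]≡[2^[K+1]]^m m K = begin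
  2 ^ (m * K + m)  ≡⟨ cong (2 ^_) (trans (ℕ.+-comm (m * K) m) (cong (m +_) (ℕ.*-comm m K))) ⟩
  2 ^ (suc K * m)  ≡⟨ sym (ℕ.^-*-assoc 2 (suc K) m) ⟩
  (2 ^ suc K) ^ m  ∎
  where open ≡-Reasoning

corollary5 : (m : ℕ) → m % 2 ≡ 1 →
    (p q : ℕ) → 0 < p → p < q →
    (D : ℕ) → Σ ℕ λ d → (D ≤ d) ×
      (∀ s → IsS2m m d s → (p ^ m) * (2 ^ (d + m ∸ 1)) ≤ (s ^ m) * (q ^ m))
corollary5 zero      ()
corollary5 m@(suc _) m-odd p q _ p<q D = suc (m * K) , D≤1+m*K , bound
  where
  open ℕ.≤-Reasoning

  K : ℕ
  K = degree D

  D≤1+m*K : D ≤ suc (m * K)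
  D≤1+m*K = ℕ.m≤n⇒m≤1+n (ℕ.≤-trans (ℕ.<⇒≤ (j<degree D)) (ℕ.m≤n*m K m))

  bound : ∀ s → IsS2m m (suc (m * K)) s → p ^ m * 2 ^ (m * K + m) ≤ s ^ m * q ^ m
  bound s (hasZeroSum , _) = begin
    p ^ m * 2 ^ (m * K + m)  ≡⟨ cong (p ^ m *_) (2^[m*K+m]≡[2^[K+1]]^m m K) ⟩
    p ^ m * (2 ^ suc K) ^ m  ≤⟨ ℕ.*-mono-≤ (ℕ.^-monoˡ-≤ m (ℕ.<⇒≤ p<q))
                                           (ℕ.^-monoˡ-≤ m (ℕ.<⇒≤ (2^[degree+1]<s m-odd D hasZeroSum))) ⟩
    q ^ m * s ^ m            ≡⟨ ℕ.*-comm (q ^ m) (s ^ m) ⟩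
    s ^ m * q ^ m            ∎
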